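{- Let $\mu\geq 2$ be an integer. If $T$ is a $\mu$-way $(v,2,1)$ trade, then the volume of $T$ is at least $\lceil\frac{\mu+1}{2}\rceil$.
   Context: For integers $v,k,t$, a $(v,k,t)$ trade is a triple $(X;T_1,T_2)$ where $X$ is a $v$-set and $T_1,T_2$ are disjoint nonempty collections of $k$-subsets (blocks) of $X$ such that every $t$-subset of $X$ is contained in the same number of blocks of $T_1$ as of $T_2$. A $\mu$-way $(v,k,t)$ trade is a pair $T=(X,\{T_1,\dots,T_\mu\})$ such that for every $i\neq j$, $(X;T_i,T_j)$ is a $(v,k,t)$ trade. All $T_i$ then have the same number of blocks, called the volume of $T$. -}

module Defs where

open import Data.Nat using (ℕ)
open import Data.Fin using (Fin)
open import Data.Fin.Subset using (Subset; ∣_∣; _⊆_)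
open import Data.Fin.Subset.Properties using (_⊆?_)
open import Data.List using (List; []; length; filter)
open import Data.List.Membership.Propositional using (_∈_; _∉_)
open import Data.List.Relation.Unary.Unique.Propositional using (Unique)
open import Relation.Binary.PropositionalEquality using (_≡_; _≢_)

occ : {v : ℕ} → Subset v → List (Subset v) → ℕ
occ S B = length (filter (S ⊆?_) B)

record MuWayTrade (μ v k t : ℕ) : Set where
  field
    T         : Fin μ → List (Subset v)
    blockSize : ∀ i b → b ∈ T i → ∣ b ∣ ≡ k
    simple    : ∀ i → Unique (T i)
    nonempty  : ∀ i → T i ≢ []
    disjoint  : ∀ i j → i ≢ j → ∀ b → b ∈ T i → b ∉ T j
    balanced  : ∀ i j → i ≢ j → ∀ (S : Subset v) → ∣ S ∣ ≡ t → occ S (T i) ≡ occ S (T j)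

-- the volume: number of blocks of T i (the same for all i)
volume : ∀ {μ v k t} → MuWayTrade μ v k t → Fin μ → ℕ
volume tr i = length (MuWayTrade.T tr i)

-- Fix a point x on a block of Tᵢ. Since every point has the same degree in all
-- the Tⱼ, each Tⱼ has a block {x, yⱼ} through x. These μ blocks are distinct,
-- as the Tⱼ are pairwise disjoint, so x, y₁, …, y_μ are μ + 1 distinct points.
-- Each yⱼ has positive degree in Tⱼ, hence in Tᵢ, so the blocks of Tᵢ cover at
-- least μ + 1 points; as each block has two points, 2 · volume ≥ μ + 1.
module Submission where

open import Defs
open import Data.Nat using (ℕ; _≤_; _+_; ⌈_/2⌉)
open import Data.Fin using (Fin)

open import Data.Nat using (suc; _*_; _<_; z≤n; s≤s; z<s)
open import Data.Nat.Properties
  using (≤-trans; ≤-reflexive; ≤⇒≯; +-identityʳ; +-comm; *-suc; *-zeroʳ;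
         ⌈n/2⌉-mono; n≡⌈n+n/2⌉; module ≤-Reasoning)
open import Data.Fin using (zero; suc)
open import Data.Fin.Properties using (any?; _≟_; injective⇒≤)
open import Data.Fin.Subset using (Subset; ∣_∣; _⊆_; ⁅_⁆; _-_; inside; outside; Nonempty)
  renaming (_∈_ to _∈ₛ_)
open import Data.Fin.Subset.Properties
  using (_⊆?_; _∈?_; x∈⁅x⁆; x∈⁅y⁆⇒x≡y; ∣⁅x⁆∣≡1; ⊆-antisym; p⊆q⇒∣p∣≤∣q∣;
         x∈p∧x∉q⇒x∈p─q; x≢y⇒x∉⁅y⁆; x∈p⇒∣p-x∣<∣p∣)
open import Data.Vec using ([]; _∷_; here; there)
open import Data.Vec.Functional as Vector using (Vector)
open import Data.List using (List; []; _∷_; _++_; length; lookup; map; concatMap)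
open import Data.List.Properties using (length-map; length-++; filter-some)
open import Data.List.Membership.Propositional using (_∈_; find; lose)
open import Data.List.Membership.Propositional.Properties using (∈-map⁺; ∈-concat⁺)
open import Data.List.Relation.Unary.Any as Any using (Any; here; there; index)
open import Data.List.Relation.Unary.Any.Properties using (lookup-index; map⁺)
open import Data.Product using (∃; _×_; _,_; proj₁; proj₂)
open import Data.Empty using (⊥-elim)
open import Function using (_∘_; _⇔_; mk⇔; Equivalence)
open import Function.Definitions using (Injective)
open import Relation.Nullary using (yes; no)
open import Relation.Nullary.Decidable using (_×-dec_; ¬?; decidable-stable)
open import Relation.Binary.PropositionalEquality
  using (_≡_; _≢_; refl; sym; trans; cong; cong₂; subst; module ≡-Reasoning)

private
  variable
    A : Set
    n : ℕ

n≤2*m⇒⌈n/2⌉≤m : ∀ {n} m → n ≤ 2 * m → ⌈ n /2⌉ ≤ m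
n≤2*m⇒⌈n/2⌉≤m {n} m n≤2m = begin
  ⌈ n /2⌉     ≤⟨ ⌈n/2⌉-mono n≤2m ⟩
  ⌈ 2 * m /2⌉ ≡⟨ cong (λ k → ⌈ m + k /2⌉) (+-identityʳ m) ⟩
  ⌈ m + m /2⌉ ≡⟨ sym (n≡⌈n+n/2⌉ m) ⟩
  m           ∎
  where open ≤-Reasoning

injective⇒≤length : {xs : List A} (f : Fin n → A) → Injective _≡_ _≡_ f →
                    (∀ a → f a ∈ xs) → n ≤ length xs
injective⇒≤length {xs = xs} f f-inj f∈xs = injective⇒≤ (f-inj ∘ lookup∘index≡)
  where
  lookup∘index≡ : ∀ {a b} → index (f∈xs a) ≡ index (f∈xs b) → f a ≡ f b
  lookup∘index≡ {a} {b} eq =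
    trans (lookup-index (f∈xs a)) (trans (cong (lookup xs) eq) (sym (lookup-index (f∈xs b))))

fresh-∷-injective : ∀ {x : A} {f : Vector A n} → (∀ a → f a ≢ x) → Injective _≡_ _≡_ f →
                    Injective _≡_ _≡_ (x Vector.∷ f)
fresh-∷-injective f≢x f-inj {zero}  {zero}  eq = refl
fresh-∷-injective f≢x f-inj {zero}  {suc b} eq = ⊥-elim (f≢x b (sym eq))
fresh-∷-injective f≢x f-inj {suc a} {zero}  eq = ⊥-elim (f≢x a eq)
fresh-∷-injective f≢x f-inj {suc a} {suc b} eq = cong suc (f-inj eq)

elements : Subset n → List (Fin n)
elements []            = []
elements (inside ∷ p)  = zero ∷ map suc (elements p)
elements (outside ∷ p) = map suc (elements p)

length-elements : (p : Subset n) → length (elements p) ≡ ∣ p ∣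
length-elements []            = refl
length-elements (inside ∷ p)  = cong suc (trans (length-map suc (elements p)) (length-elements p))
length-elements (outside ∷ p) = trans (length-map suc (elements p)) (length-elements p)

∈⇒∈elements : ∀ {x : Fin n} {p} → x ∈ₛ p → x ∈ elements p
∈⇒∈elements {p = inside ∷ p}  here        = here refl
∈⇒∈elements {p = inside ∷ p}  (there x∈p) = there (∈-map⁺ suc (∈⇒∈elements x∈p))
∈⇒∈elements {p = outside ∷ p} (there x∈p) = ∈-map⁺ suc (∈⇒∈elements x∈p)

x∈p⇔⁅x⁆⊆p : ∀ {x : Fin n} {p} → x ∈ₛ p ⇔ ⁅ x ⁆ ⊆ p
x∈p⇔⁅x⁆⊆p {x = x} = mk⇔ (λ x∈p {y} y∈⁅x⁆ → subst (_∈ₛ _) (sym (x∈⁅y⁆⇒x≡y x y∈⁅x⁆)) x∈p)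
                        (λ ⁅x⁆⊆p → ⁅x⁆⊆p (x∈⁅x⁆ x))

∣p∣>0⇒Nonempty : ∀ {p : Subset n} → 0 < ∣ p ∣ → Nonempty p
∣p∣>0⇒Nonempty {p = inside ∷ p}  _     = zero , here
∣p∣>0⇒Nonempty {p = outside ∷ p} ∣p∣>0 = let x , x∈p = ∣p∣>0⇒Nonempty ∣p∣>0 in suc x , there x∈p

x∈p∧x≢y⇒x∈p-y : ∀ {x y : Fin n} {p} → x ∈ₛ p → x ≢ y → x ∈ₛ p - y
x∈p∧x≢y⇒x∈p-y x∈p x≢y = x∈p∧x∉q⇒x∈p─q x∈p (x≢y⇒x∉⁅y⁆ x≢y)

module _ {p : Subset n} (∣p∣≡2 : ∣ p ∣ ≡ 2) where

  ∣p∣≡2⇒∃≢ : ∀ {x} → x ∈ₛ p → ∃ λ y → y ∈ₛ p × y ≢ x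
  ∣p∣≡2⇒∃≢ {x} x∈p with any? (λ y → (y ∈? p) ×-dec ¬? (y ≟ x))
  ... | yes y = y
  ... | no ∄y = ⊥-elim (≤⇒≯ ∣p∣≤1 (≤-reflexive (sym ∣p∣≡2)))
    where
    p⊆⁅x⁆ : p ⊆ ⁅ x ⁆
    p⊆⁅x⁆ {y} y∈p with y ≟ x
    ... | yes refl = x∈⁅x⁆ x
    ... | no y≢x   = ⊥-elim (∄y (y , y∈p , y≢x))
    ∣p∣≤1 : ∣ p ∣ ≤ 1
    ∣p∣≤1 = ≤-trans (p⊆q⇒∣p∣≤∣q∣ p⊆⁅x⁆) (≤-reflexive (∣⁅x⁆∣≡1 x))

  ∣p∣≡2⇒⊆ : ∀ {x y q} → y ≢ x → x ∈ₛ p → y ∈ₛ p → x ∈ₛ q → y ∈ₛ q → p ⊆ q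
  ∣p∣≡2⇒⊆ {x} {y} y≢x x∈p y∈p x∈q y∈q {z} z∈p with z ≟ x | z ≟ y
  ... | yes refl | _        = x∈q
  ... | no _     | yes refl = y∈q
  ... | no z≢x   | no z≢y   = ⊥-elim (≤⇒≯ (≤-reflexive ∣p∣≡2) 3≤∣p∣)
    where
    open ≤-Reasoning
    3≤∣p∣ : 3 ≤ ∣ p ∣
    3≤∣p∣ = begin
      3                     ≤⟨ s≤s (s≤s (s≤s z≤n)) ⟩
      3 + ∣ p - x - y - z ∣ ≤⟨ s≤s (s≤s (x∈p⇒∣p-x∣<∣p∣ (x∈p∧x≢y⇒x∈p-y (x∈p∧x≢y⇒x∈p-y z∈p z≢x) z≢y))) ⟩
      2 + ∣ p - x - y ∣     ≤⟨ s≤s (x∈p⇒∣p-x∣<∣p∣ (x∈p∧x≢y⇒x∈p-y y∈p y≢x)) ⟩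
      1 + ∣ p - x ∣         ≤⟨ x∈p⇒∣p-x∣<∣p∣ x∈p ⟩
      ∣ p ∣                 ∎

∣p∣≡∣q∣≡2⇒≡ : ∀ {p q : Subset n} {x y} → ∣ p ∣ ≡ 2 → ∣ q ∣ ≡ 2 → y ≢ x →
              x ∈ₛ p → y ∈ₛ p → x ∈ₛ q → y ∈ₛ q → p ≡ q
∣p∣≡∣q∣≡2⇒≡ ∣p∣≡2 ∣q∣≡2 y≢x x∈p y∈p x∈q y∈q =
  ⊆-antisym (∣p∣≡2⇒⊆ ∣p∣≡2 y≢x x∈p y∈p x∈q y∈q) (∣p∣≡2⇒⊆ ∣q∣≡2 y≢x x∈q y∈q x∈p y∈p)

points : List (Subset n) → List (Fin n)
points = concatMap elements

Any∈⇒∈points : ∀ {x : Fin n} {B} → Any (x ∈ₛ_) B → x ∈ points B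
Any∈⇒∈points x∈B = ∈-concat⁺ (map⁺ (Any.map ∈⇒∈elements x∈B))

length-points : ∀ {k} (B : List (Subset n)) → (∀ b → b ∈ B → ∣ b ∣ ≡ k) →
                length (points B) ≡ k * length B
length-points {k = k} []      _    = sym (*-zeroʳ k)
length-points {k = k} (b ∷ B) ∣B∣≡k = begin
  length (elements b ++ points B)        ≡⟨ length-++ (elements b) ⟩
  length (elements b) + length (points B) ≡⟨ cong₂ _+_ (trans (length-elements b) (∣B∣≡k b (here refl)))
                                                       (length-points B (λ c → ∣B∣≡k c ∘ there)) ⟩
  k + k * length B                        ≡⟨ sym (*-suc k (length B)) ⟩
  k * suc (length B)                      ∎
  where open ≡-Reasoning

module _ {x : Fin n} where

  Any∈⇒occ⁅x⁆>0 : ∀ {B} → Any (x ∈ₛ_) B → 0 < occ ⁅ x ⁆ B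
  Any∈⇒occ⁅x⁆>0 = filter-some (⁅ x ⁆ ⊆?_) ∘ Any.map (Equivalence.to x∈p⇔⁅x⁆⊆p)

  occ⁅x⁆>0⇒Any∈ : ∀ B → 0 < occ ⁅ x ⁆ B → Any (x ∈ₛ_) B
  occ⁅x⁆>0⇒Any∈ (b ∷ B) occ>0 with ⁅ x ⁆ ⊆? b
  ... | yes ⁅x⁆⊆b = here (Equivalence.from x∈p⇔⁅x⁆⊆p ⁅x⁆⊆b)
  ... | no _      = there (occ⁅x⁆>0⇒Any∈ B occ>0)

module _ {μ v k} (tr : MuWayTrade μ v k 1) where
  open MuWayTrade tr

  occ⁅x⁆-uniform : ∀ i j (x : Fin v) → occ ⁅ x ⁆ (T i) ≡ occ ⁅ x ⁆ (T j)
  occ⁅x⁆-uniform i j x with i ≟ j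
  ... | yes refl = refl
  ... | no i≢j   = balanced i j i≢j ⁅ x ⁆ (∣⁅x⁆∣≡1 x)

  Any∈-transfer : ∀ i j {x} → Any (x ∈ₛ_) (T i) → Any (x ∈ₛ_) (T j)
  Any∈-transfer i j {x} x∈Tᵢ =
    occ⁅x⁆>0⇒Any∈ (T j) (subst (0 <_) (occ⁅x⁆-uniform i j x) (Any∈⇒occ⁅x⁆>0 x∈Tᵢ))

module _ {μ v} (tr : MuWayTrade μ v 2 1) where
  open MuWayTrade tr

  ∃-covered-point : ∀ i → ∃ λ x → Any (x ∈ₛ_) (T i)
  ∃-covered-point i with T i | nonempty i | blockSize i
  ... | []    | T≢[] | _     = ⊥-elim (T≢[] refl)
  ... | b ∷ _ | _    | ∣T∣≡2 =
    let x , x∈b = ∣p∣>0⇒Nonempty (subst (0 <_) (sym (∣T∣≡2 b (here refl))) z<s) in x , here x∈b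

  module Partners (i : Fin μ) {x : Fin v} (x∈Tᵢ : Any (x ∈ₛ_) (T i)) where

    block : Fin μ → Subset v
    block j = proj₁ (find (Any∈-transfer tr i j x∈Tᵢ))

    block∈T : ∀ j → block j ∈ T j
    block∈T j = proj₁ (proj₂ (find (Any∈-transfer tr i j x∈Tᵢ)))

    x∈block : ∀ j → x ∈ₛ block j
    x∈block j = proj₂ (proj₂ (find (Any∈-transfer tr i j x∈Tᵢ)))

    ∣block∣≡2 : ∀ j → ∣ block j ∣ ≡ 2
    ∣block∣≡2 j = blockSize j (block j) (block∈T j)

    partner : Fin μ → Fin v
    partner j = proj₁ (∣p∣≡2⇒∃≢ (∣block∣≡2 j) (x∈block j))

    partner∈block : ∀ j → partner j ∈ₛ block j
    partner∈block j = proj₁ (proj₂ (∣p∣≡2⇒∃≢ (∣block∣≡2 j) (x∈block j)))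

    partner≢x : ∀ j → partner j ≢ x
    partner≢x j = proj₂ (proj₂ (∣p∣≡2⇒∃≢ (∣block∣≡2 j) (x∈block j)))

    partner-injective : Injective _≡_ _≡_ partner
    partner-injective {j} {k} eq = decidable-stable (j ≟ k) λ j≢k →
      disjoint j k j≢k (block j) (block∈T j) (subst (_∈ T k) (sym blockⱼ≡blockₖ) (block∈T k))
      where
      blockⱼ≡blockₖ : block j ≡ block k
      blockⱼ≡blockₖ = ∣p∣≡∣q∣≡2⇒≡ (∣block∣≡2 j) (∣block∣≡2 k) (partner≢x j)
        (x∈block j) (partner∈block j) (x∈block k) (subst (_∈ₛ block k) (sym eq) (partner∈block k))

    partner-covered : ∀ j → Any (partner j ∈ₛ_) (T i)
    partner-covered j = Any∈-transfer tr j i (lose (block∈T j) (partner∈block j))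

  1+μ≤2*volume : ∀ i → suc μ ≤ 2 * volume tr i
  1+μ≤2*volume i = subst (suc μ ≤_) (length-points (T i) (blockSize i))
    (injective⇒≤length (x Vector.∷ partner) (fresh-∷-injective partner≢x partner-injective) covered)
    where
    x    = proj₁ (∃-covered-point i)
    x∈Tᵢ = proj₂ (∃-covered-point i)
    open Partners i x∈Tᵢ
    covered : ∀ a → (x Vector.∷ partner) a ∈ points (T i)
    covered zero    = Any∈⇒∈points x∈Tᵢ
    covered (suc j) = Any∈⇒∈points (partner-covered j)

theorem3p2 : (μ v : ℕ) → 2 ≤ μ → (tr : MuWayTrade μ v 2 1) →
    ∀ (i : Fin μ) → ⌈ (μ + 1) /2⌉ ≤ volume tr i
theorem3p2 μ v _ tr i =
  n≤2*m⇒⌈n/2⌉≤m (volume tr i) (subst (_≤ 2 * volume tr i) (+-comm 1 μ) (1+μ≤2*volume tr i))
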